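{- A tree $(T;<)$ is pathwise complete if and only if it is weakly branching complete, weakly branching point complete, and each of its maximal bridges is Dedekind complete as a linear order.
   Context: A tree is a set $T$ with a strict partial order $<$ such that for every $x\in T$ the set $\{y:y<x\}$ is linearly ordered, and any two nodes have a common lower bound (no well-foundedness or root assumed). A path is a maximal linearly ordered set of nodes. Pathwise complete: for every path $\mathsf{P}$ and non-empty $X\subseteq\mathsf{P}$ bounded below, $X$ has an infimum in $\mathsf{P}$. Weakly branching complete: for any distinct paths $\mathsf{P},\mathsf{Q}$, $\mathsf{P}\cap\mathsf{Q}$ has a supremum in $\mathsf{P}$ and in $\mathsf{Q}$. A weakly branching point is a node that, for some distinct paths $\mathsf{P},\mathsf{Q}$, is the supremum in $\mathsf{P}$ of $\mathsf{P}\cap\mathsf{Q}$. Weakly branching point complete: for every path $\mathsf{P}$ and non-empty set $X$ of weakly branching points on $\mathsf{P}$, if $X$ is bounded below (resp. above) it has an infimum (resp. supremum) in $\mathsf{P}$. A bridge is a non-empty convex chain $\mathsf{J}$ such that for every path $\mathsf{P}$ either $\mathsf{J}\subseteq\mathsf{P}$ or $\mathsf{J}\cap\mathsf{P}=\emptyset$; maximal bridges are maximal by inclusion. A linear order is Dedekind complete if every non-empty subset bounded below has an infimum. -}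

module Defs where

open import Level using (Level; suc; _⊔_)
open import Data.Product using (Σ; ∃; _×_; _,_)
open import Data.Sum using (_⊎_)
open import Data.Empty using (⊥)
open import Relation.Nullary using (¬_)
open import Relation.Binary.PropositionalEquality using (_≡_)
open import Relation.Unary using (Pred; _∈_; _⊆_)

-- A tree: strict partial order, predecessors of each node linearly ordered,
-- any two nodes have a common lower bound. No root / well-foundedness assumed.
record Tree (ℓ : Level) : Set (suc ℓ) where
  field
    Carrier : Set ℓ
    _<_     : Carrier → Carrier → Set ℓ
    <-irrefl : ∀ x → ¬ (x < x)
    <-trans  : ∀ {x y z} → x < y → y < z → x < z
    pred-linear : ∀ {x y z} → y < x → z < x → (y < z ⊎ y ≡ z ⊎ z < y)
    common-lb : ∀ x y → ∃ λ z → (z < x ⊎ z ≡ x) × (z < y ⊎ z ≡ y)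

module TreeNotions {ℓ : Level} (T : Tree ℓ) where
  open Tree T

  Subset : Set (suc ℓ)
  Subset = Pred Carrier ℓ

  _≤_ : Carrier → Carrier → Set ℓ
  x ≤ y = x < y ⊎ x ≡ y

  NonEmpty : Subset → Set ℓ
  NonEmpty X = ∃ λ x → x ∈ X

  Disjoint : Subset → Subset → Set ℓ
  Disjoint X Y = ∀ x → x ∈ X → x ∈ Y → ⊥

  IsChain : Subset → Set ℓ
  IsChain S = ∀ {x y} → x ∈ S → y ∈ S → x < y ⊎ x ≡ y ⊎ y < x

  IsPath : Subset → Set (suc ℓ)
  IsPath P = IsChain P × (∀ (S : Subset) → IsChain S → P ⊆ S → S ⊆ P)

  LowerBound : Subset → Carrier → Set ℓ
  LowerBound X b = ∀ {x} → x ∈ X → b ≤ x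

  UpperBound : Subset → Carrier → Set ℓ
  UpperBound X b = ∀ {x} → x ∈ X → x ≤ b

  BoundedBelow : Subset → Set ℓ
  BoundedBelow X = ∃ λ b → LowerBound X b

  BoundedAbove : Subset → Set ℓ
  BoundedAbove X = ∃ λ b → UpperBound X b

  IsInfIn : Subset → Subset → Carrier → Set ℓ
  IsInfIn P X m = m ∈ P × LowerBound X m × (∀ b → b ∈ P → LowerBound X b → b ≤ m)

  IsSupIn : Subset → Subset → Carrier → Set ℓ
  IsSupIn P X s = s ∈ P × UpperBound X s × (∀ b → b ∈ P → UpperBound X b → s ≤ b)

  HasInfIn : Subset → Subset → Set ℓ
  HasInfIn P X = ∃ λ m → IsInfIn P X m

  HasSupIn : Subset → Subset → Set ℓ
  HasSupIn P X = ∃ λ s → IsSupIn P X s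

  _∩_ : Subset → Subset → Subset
  (P ∩ Q) x = x ∈ P × x ∈ Q

  Distinct : Subset → Subset → Set ℓ
  Distinct P Q = ¬ (P ⊆ Q × Q ⊆ P)

  PathwiseComplete : Set (suc ℓ)
  PathwiseComplete = ∀ (P : Subset) → IsPath P → ∀ (X : Subset) → X ⊆ P →
    NonEmpty X → BoundedBelow X → HasInfIn P X

  WeaklyBranchingComplete : Set (suc ℓ)
  WeaklyBranchingComplete = ∀ (P Q : Subset) → IsPath P → IsPath Q → Distinct P Q →
    HasSupIn P (P ∩ Q) × HasSupIn Q (P ∩ Q)

  WeaklyBranchingPoint : Carrier → Set (suc ℓ)
  WeaklyBranchingPoint x = Σ Subset λ P → Σ Subset λ Q →
    IsPath P × IsPath Q × Distinct P Q × IsSupIn P (P ∩ Q) x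

  WeaklyBranchingPointComplete : Set (suc ℓ)
  WeaklyBranchingPointComplete = ∀ (P : Subset) → IsPath P → ∀ (X : Subset) → X ⊆ P →
    (∀ {x} → x ∈ X → WeaklyBranchingPoint x) → NonEmpty X →
    (BoundedBelow X → HasInfIn P X) × (BoundedAbove X → HasSupIn P X)

  IsConvex : Subset → Set ℓ
  IsConvex J = ∀ {x y z} → x ∈ J → z ∈ J → x ≤ y → y ≤ z → y ∈ J

  IsBridge : Subset → Set (suc ℓ)
  IsBridge J = NonEmpty J × IsConvex J × IsChain J ×
    (∀ (P : Subset) → IsPath P → J ⊆ P ⊎ Disjoint J P)

  IsMaximalBridge : Subset → Set (suc ℓ)
  IsMaximalBridge J = IsBridge J × (∀ (J' : Subset) → IsBridge J' → J ⊆ J' → J' ⊆ J)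

  DedekindComplete : Subset → Set (suc ℓ)
  DedekindComplete J = ∀ (X : Subset) → X ⊆ J → NonEmpty X →
    (∃ λ b → b ∈ J × LowerBound X b) → HasInfIn J X

{-# OPTIONS --safe #-}
module Submission where

-- Forward: the supremum of P ∩ Q in P is either its maximum or the infimum of P ∖ Q; a
-- supremum in a path is the infimum of the upper bounds lying on it; and a maximal bridge
-- lies on a path, where infima of its subsets stay in it by convexity.
-- Backward: split the weakly branching points of P into the lower bounds L of X and the
-- rest U. If U is coinitial in X, inf U = inf X. Otherwise some x₀ ∈ X is the minimum or
-- lies strictly between L and U. The points of P strictly between L and U contain no
-- weakly branching point, so no path can leave P among them: they form a bridge, which
-- extends to a maximal bridge J. If J contains a lower bound of X, Dedekind completeness
-- of J yields inf X; otherwise sup L = inf X.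

open import Defs
open import Level using (Level; Lift; lift; lower)
open import Data.Product using (_×_; Σ; ∃; _,_; proj₁; proj₂; swap)
open import Data.Sum using (_⊎_; inj₁; inj₂)
open import Data.Empty using (⊥; ⊥-elim)
open import Relation.Nullary using (¬_; yes; no)
open import Relation.Nullary.Decidable.Core using (True; fromWitness; toWitness)
open import Relation.Binary.PropositionalEquality using (_≡_; refl; sym)
open import Relation.Unary using (_∈_; _∉_; _⊆_; _∪_; _∖_)
open import Function.Bundles using (_⇔_; mk⇔)
open import Axiom.ExcludedMiddle using (ExcludedMiddle)
open import Axiom.DoubleNegationElimination using (em⇒dne)

module TreeOrder {ℓ : Level} (T : Tree ℓ) where
  open Tree T
  open TreeNotions T

  Comparable : Carrier → Carrier → Set ℓ
  Comparable x y = x < y ⊎ x ≡ y ⊎ y < x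

  comparable-sym : ∀ {x y} → Comparable x y → Comparable y x
  comparable-sym (inj₁ x<y)        = inj₂ (inj₂ x<y)
  comparable-sym (inj₂ (inj₁ x≡y)) = inj₂ (inj₁ (sym x≡y))
  comparable-sym (inj₂ (inj₂ y<x)) = inj₁ y<x

  ≤-refl : ∀ {x} → x ≤ x
  ≤-refl = inj₂ refl

  ≤-trans : ∀ {x y z} → x ≤ y → y ≤ z → x ≤ z
  ≤-trans (inj₁ x<y)  (inj₁ y<z)  = inj₁ (<-trans x<y y<z)
  ≤-trans (inj₁ x<y)  (inj₂ refl) = inj₁ x<y
  ≤-trans (inj₂ refl) y≤z         = y≤z

  <-≤-trans : ∀ {x y z} → x < y → y ≤ z → x < z
  <-≤-trans x<y (inj₁ y<z)  = <-trans x<y y<z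
  <-≤-trans x<y (inj₂ refl) = x<y

  ≤-<-trans : ∀ {x y z} → x ≤ y → y < z → x < z
  ≤-<-trans (inj₁ x<y)  y<z = <-trans x<y y<z
  ≤-<-trans (inj₂ refl) y<z = y<z

  ≤⇒≯ : ∀ {x y} → x ≤ y → ¬ (y < x)
  ≤⇒≯ {x} x≤y y<x = <-irrefl x (≤-<-trans x≤y y<x)

  comparable⇒≤ : ∀ {x y} → Comparable x y → ¬ (y < x) → x ≤ y
  comparable⇒≤ (inj₁ x<y)        _   = inj₁ x<y
  comparable⇒≤ (inj₂ (inj₁ x≡y)) _   = inj₂ x≡y
  comparable⇒≤ (inj₂ (inj₂ y<x)) y≮x = ⊥-elim (y≮x y<x)

  comparable⇒< : ∀ {x y} → Comparable x y → ¬ (y ≤ x) → x < y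
  comparable⇒< (inj₁ x<y)        _   = x<y
  comparable⇒< (inj₂ (inj₁ x≡y)) y≰x = ⊥-elim (y≰x (inj₂ (sym x≡y)))
  comparable⇒< (inj₂ (inj₂ y<x)) y≰x = ⊥-elim (y≰x (inj₁ y<x))

  comparable-below : ∀ {x y t} → x ≤ t → y ≤ t → Comparable x y
  comparable-below (inj₁ x<t)  (inj₁ y<t)  = pred-linear x<t y<t
  comparable-below (inj₁ x<t)  (inj₂ refl) = inj₁ x<t
  comparable-below (inj₂ refl) (inj₁ y<t)  = inj₂ (inj₂ y<t)
  comparable-below (inj₂ refl) (inj₂ refl) = inj₂ (inj₁ refl)

  comparable-downward : ∀ {p x y} → y ≤ x → Comparable p x → Comparable p y
  comparable-downward y≤x (inj₁ p<x)        = comparable-below (inj₁ p<x) y≤x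
  comparable-downward y≤x (inj₂ (inj₁ refl)) = comparable-sym (comparable-below y≤x ≤-refl)
  comparable-downward y≤x (inj₂ (inj₂ x<p)) = inj₂ (inj₂ (≤-<-trans y≤x x<p))

  path-absorbs : ∀ {P y} → IsPath P → (∀ {p} → p ∈ P → Comparable p y) → y ∈ P
  path-absorbs {P} {y} (P-chain , P-maximal) cmp = P-maximal S S-chain inj₁ (inj₂ refl)
    where
    S : Subset
    S z = z ∈ P ⊎ z ≡ y
    S-chain : IsChain S
    S-chain (inj₁ p∈P)  (inj₁ q∈P)  = P-chain p∈P q∈P
    S-chain (inj₁ p∈P)  (inj₂ refl) = cmp p∈P
    S-chain (inj₂ refl) (inj₁ q∈P)  = comparable-sym (cmp q∈P)
    S-chain (inj₂ refl) (inj₂ refl) = inj₂ (inj₁ refl)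

  path-downClosed : ∀ {P x y} → IsPath P → x ∈ P → y ≤ x → y ∈ P
  path-downClosed P-path x∈P y≤x =
    path-absorbs P-path λ p∈P → comparable-downward y≤x (proj₁ P-path p∈P x∈P)

  path-⊆⇒⊇ : ∀ {P Q} → IsPath P → IsPath Q → P ⊆ Q → Q ⊆ P
  path-⊆⇒⊇ P-path Q-path = proj₂ P-path _ (proj₁ Q-path)

  bridge⊆path : ∀ {P K x} → IsPath P → IsBridge K → x ∈ K → x ∈ P → K ⊆ P
  bridge⊆path {P} P-path (_ , _ , _ , K-bridge) x∈K x∈P with K-bridge P P-path
  ... | inj₁ K⊆P     = K⊆P
  ... | inj₂ K∩P≡∅ = ⊥-elim (K∩P≡∅ _ x∈K x∈P)

  hasSupIn-cong : ∀ {P X Y} → X ⊆ Y → Y ⊆ X → HasSupIn P X → HasSupIn P Y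
  hasSupIn-cong X⊆Y Y⊆X (s , s∈P , s-ub , s-least) =
    s , s∈P , (λ y∈Y → s-ub (Y⊆X y∈Y)) ,
    λ b b∈P b-ub → s-least b b∈P (λ x∈X → b-ub (X⊆Y x∈X))

  minimum-isInf : ∀ {P X x} → x ∈ P → x ∈ X → LowerBound X x → IsInfIn P X x
  minimum-isInf x∈P x∈X x-lb = x∈P , x-lb , λ _ _ b-lb → b-lb x∈X

  isInf-coinitial : ∀ {P X Y m} →
    (∀ {y} → y ∈ Y → ∃ λ x → x ∈ X × x ≤ y) → (∀ {x} → x ∈ X → ∃ λ y → y ∈ Y × y ≤ x) →
    IsInfIn P Y m → IsInfIn P X m
  isInf-coinitial Y≥X X≥Y (m∈P , m-lb , m-greatest) =
    m∈P ,
    (λ x∈X → let (y , y∈Y , y≤x) = X≥Y x∈X in ≤-trans (m-lb y∈Y) y≤x) ,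
    λ b b∈P b-lb → m-greatest b b∈P λ y∈Y →
      let (x , x∈X , x≤y) = Y≥X y∈Y in ≤-trans (b-lb x∈X) x≤y

  convex-dedekindComplete⇒hasInfIn : ∀ {P J X x₀ l} → IsPath P → X ⊆ P → J ⊆ P →
    IsConvex J → DedekindComplete J → x₀ ∈ X → x₀ ∈ J → l ∈ J → LowerBound X l → HasInfIn P X
  convex-dedekindComplete⇒hasInfIn {P} {J} {X} {x₀} P-path X⊆P J⊆P J-convex J-complete
    x₀∈X x₀∈J l∈J l-lb = n , J⊆P n∈J , n-lb , n-greatest
    where
    X∩J-inf : HasInfIn J (X ∩ J)
    X∩J-inf = J-complete (X ∩ J) proj₂ (x₀ , x₀∈X , x₀∈J)
      (_ , l∈J , λ y∈X∩J → l-lb (proj₁ y∈X∩J))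
    n = proj₁ X∩J-inf
    n∈J = proj₁ (proj₂ X∩J-inf)
    n≤X∩J = proj₁ (proj₂ (proj₂ X∩J-inf))
    n≥lb = proj₂ (proj₂ (proj₂ X∩J-inf))
    n-lb : LowerBound X n
    n-lb {x} x∈X with proj₁ P-path (X⊆P x∈X) (X⊆P x₀∈X)
    ... | inj₁ x<x₀        = n≤X∩J (x∈X , J-convex l∈J x₀∈J (l-lb x∈X) (inj₁ x<x₀))
    ... | inj₂ (inj₁ refl) = n≤X∩J (x∈X , x₀∈J)
    ... | inj₂ (inj₂ x₀<x) = ≤-trans (n≤X∩J (x₀∈X , x₀∈J)) (inj₁ x₀<x)
    n-greatest : ∀ b → b ∈ P → LowerBound X b → b ≤ n
    n-greatest b b∈P b-lb = comparable⇒≤ (proj₁ P-path b∈P (J⊆P n∈J)) λ n<b →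
      ≤⇒≯ (n≥lb b (J-convex n∈J x₀∈J (inj₁ n<b) (b-lb x₀∈X)) λ y∈X∩J → b-lb (proj₁ y∈X∩J)) n<b

  ∩-below-outside : ∀ {P Q x z} → IsPath P → IsPath Q → x ∈ P ∩ Q → z ∈ P ∖ Q → x ≤ z
  ∩-below-outside P-path Q-path (x∈P , x∈Q) (z∈P , z∉Q) =
    comparable⇒≤ (proj₁ P-path x∈P z∈P) λ z<x → z∉Q (path-downClosed Q-path x∈Q (inj₁ z<x))

  ↓_ : Subset → Subset
  (↓ J) y = ∃ λ j → j ∈ J × y ≤ j

  ↓-isChain : ∀ {J} → IsChain J → IsChain (↓ J)
  ↓-isChain J-chain (j₁ , j₁∈J , y₁≤j₁) (j₂ , j₂∈J , y₂≤j₂) with J-chain j₁∈J j₂∈J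
  ... | inj₁ j₁<j₂        = comparable-below (≤-trans y₁≤j₁ (inj₁ j₁<j₂)) y₂≤j₂
  ... | inj₂ (inj₁ refl)  = comparable-below y₁≤j₁ y₂≤j₂
  ... | inj₂ (inj₂ j₂<j₁) = comparable-below y₁≤j₁ (≤-trans y₂≤j₂ (inj₁ j₂<j₁))

  Interval : Carrier → Carrier → Subset
  Interval a b y = a ≤ y × y ≤ b

  ∪-Interval-isConvex : ∀ {J a b} → IsConvex J → a ∈ J → IsConvex (J ∪ Interval a b)
  ∪-Interval-isConvex J-convex a∈J (inj₁ x∈J) (inj₁ z∈J) x≤y y≤z = inj₁ (J-convex x∈J z∈J x≤y y≤z)
  ∪-Interval-isConvex J-convex a∈J (inj₁ x∈J) (inj₂ (a≤z , z≤b)) x≤y y≤z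
    with comparable-below y≤z a≤z
  ... | inj₁ y<a        = inj₁ (J-convex x∈J a∈J x≤y (inj₁ y<a))
  ... | inj₂ (inj₁ refl) = inj₁ a∈J
  ... | inj₂ (inj₂ a<y) = inj₂ (inj₁ a<y , ≤-trans y≤z z≤b)
  ∪-Interval-isConvex J-convex a∈J (inj₂ (a≤x , _)) (inj₁ z∈J) x≤y y≤z =
    inj₁ (J-convex a∈J z∈J (≤-trans a≤x x≤y) y≤z)
  ∪-Interval-isConvex J-convex a∈J (inj₂ (a≤x , _)) (inj₂ (_ , z≤b)) x≤y y≤z =
    inj₂ (≤-trans a≤x x≤y , ≤-trans y≤z z≤b)

  ∪-Interval-isChain : ∀ {J a b} → IsChain J → (∀ {j} → j ∈ J → Comparable j b) →
    IsChain (J ∪ Interval a b)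
  ∪-Interval-isChain J-chain J≷b (inj₁ x∈J)      (inj₁ y∈J)      = J-chain x∈J y∈J
  ∪-Interval-isChain J-chain J≷b (inj₁ x∈J)      (inj₂ (_ , y≤b)) = comparable-downward y≤b (J≷b x∈J)
  ∪-Interval-isChain J-chain J≷b (inj₂ (_ , x≤b)) (inj₁ y∈J)      =
    comparable-sym (comparable-downward x≤b (J≷b y∈J))
  ∪-Interval-isChain J-chain J≷b (inj₂ (_ , x≤b)) (inj₂ (_ , y≤b)) = comparable-below x≤b y≤b

module Classical (em : ∀ {a} → ExcludedMiddle a) {ℓ : Level} (T : Tree ℓ) where
  open Tree T
  open TreeNotions T
  open TreeOrder T

  dne : ∀ {a} {A : Set a} → ¬ ¬ A → A
  dne = em⇒dne em

  ¬∀⇒∃¬ : ∀ {X R : Subset} → ¬ (∀ {x} → x ∈ X → R x) → ∃ λ x → x ∈ X × ¬ R x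
  ¬∀⇒∃¬ ¬∀ = dne λ ¬∃ → ¬∀ λ {x} x∈X → dne λ ¬Rx → ¬∃ (x , x∈X , ¬Rx)

  -- Excluded middle makes every proposition equivalent to one in Set ℓ; this is
  -- needed to form subsets defined by quantifying over subsets or paths.
  Resize : ∀ {a} → Set a → Set ℓ
  Resize A = Lift ℓ (True (em {P = A}))

  resize : ∀ {a} {A : Set a} → A → Resize A
  resize x = lift (fromWitness x)

  unresize : ∀ {a} {A : Set a} → Resize A → A
  unresize r = toWitness (lower r)

  ¬lowerBound⇒above : ∀ {P X w} → IsPath P → X ⊆ P → w ∈ P → ¬ LowerBound X w →
    ∃ λ x → x ∈ X × x < w
  ¬lowerBound⇒above {X = X} {w} P-path X⊆P w∈P ¬w-lb =
    let (x , x∈X , w≰x) = ¬∀⇒∃¬ {X} {w ≤_} ¬w-lb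
    in x , x∈X , comparable⇒< (proj₁ P-path (X⊆P x∈X) w∈P) w≰x

  paths-meet : ∀ {P Q p} → IsPath P → IsPath Q → p ∈ P → NonEmpty (P ∩ Q)
  paths-meet {Q = Q} {p} P-path Q-path p∈P =
    z , path-downClosed P-path p∈P z≤p , path-downClosed Q-path q∈Q z≤q
    where
    Q-nonEmpty : NonEmpty Q
    Q-nonEmpty = dne λ Q-empty →
      Q-empty (p , path-absorbs Q-path λ q∈Q → ⊥-elim (Q-empty (_ , q∈Q)))
    q = proj₁ Q-nonEmpty
    q∈Q = proj₂ Q-nonEmpty
    z = proj₁ (common-lb p q)
    z≤p = proj₁ (proj₂ (common-lb p q))
    z≤q = proj₂ (proj₂ (common-lb p q))

  upperBound-inPath : ∀ {P X u} → IsPath P → X ⊆ P → UpperBound X u →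
    ∃ λ p → p ∈ P × UpperBound X p
  upperBound-inPath {P} {X} {u} P-path X⊆P u-ub = dne λ none → none (u , u∈P none , u-ub)
    where
    u∈P : ¬ (∃ λ p → p ∈ P × UpperBound X p) → u ∈ P
    u∈P none = path-absorbs P-path λ {p} p∈P →
      let (x , x∈X , x≰p) = ¬∀⇒∃¬ {X} {_≤ p} λ p-ub → none (p , p∈P , p-ub)
      in inj₁ (<-≤-trans (comparable⇒< (proj₁ P-path p∈P (X⊆P x∈X)) x≰p) (u-ub x∈X))

  -- Without a choice principle a path through J must be found by hand: if no path met
  -- J, maximality of J would make its downward closure a path.
  maximalBridge⊆path : ∀ {J} → IsMaximalBridge J → Σ Subset λ P → IsPath P × J ⊆ P
  maximalBridge⊆path {J} (J-bridge@((j₀ , j₀∈J) , J-convex , J-chain , _) , J-maximal)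
    with em {P = Σ Subset λ P → IsPath P × NonEmpty (J ∩ P)}
  ... | yes (P , P-path , j , j∈J , j∈P) = P , P-path , bridge⊆path P-path J-bridge j∈J j∈P
  ... | no no-path-meets-J =
    ⊥-elim (no-path-meets-J
      (↓ J , (↓-isChain J-chain , ↓J-maximal) , j₀ , j₀∈J , j₀ , j₀∈J , ≤-refl))
    where
    ↓J-maximal : ∀ S → IsChain S → ↓ J ⊆ S → S ⊆ ↓ J
    ↓J-maximal S S-chain ↓J⊆S {s} s∈S with S-chain s∈S (↓J⊆S (j₀ , j₀∈J , ≤-refl))
    ... | inj₁ s<j₀        = j₀ , j₀∈J , inj₁ s<j₀
    ... | inj₂ (inj₁ s≡j₀) = j₀ , j₀∈J , inj₂ s≡j₀
    ... | inj₂ (inj₂ j₀<s) = s , J-maximal K K-bridge inj₁ (inj₂ (inj₁ j₀<s , ≤-refl)) , ≤-refl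
      where
      K : Subset
      K = J ∪ Interval j₀ s
      K-meets⇒J-meets : ∀ {Q y} → IsPath Q → y ∈ K → y ∈ Q → NonEmpty (J ∩ Q)
      K-meets⇒J-meets _      (inj₁ y∈J)       y∈Q = _ , y∈J , y∈Q
      K-meets⇒J-meets Q-path (inj₂ (j₀≤y , _)) y∈Q = j₀ , j₀∈J , path-downClosed Q-path y∈Q j₀≤y
      K-bridge : IsBridge K
      K-bridge = (j₀ , inj₁ j₀∈J) , ∪-Interval-isConvex J-convex j₀∈J ,
        ∪-Interval-isChain J-chain (λ j∈J → S-chain (↓J⊆S (_ , j∈J , ≤-refl)) s∈S) ,
        λ Q Q-path → inj₂ λ y y∈K y∈Q →
          no-path-meets-J (Q , Q-path , K-meets⇒J-meets Q-path y∈K y∈Q)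

  module BridgesThrough {P x₀} (P-path : IsPath P) (x₀∈P : x₀ ∈ P) where

    Hull : Subset
    Hull y = Resize (Σ Subset λ K → IsBridge K × x₀ ∈ K × y ∈ K)

    bridge⊆Hull : ∀ {K} → IsBridge K → x₀ ∈ K → K ⊆ Hull
    bridge⊆Hull K-bridge x₀∈K y∈K = resize (_ , K-bridge , x₀∈K , y∈K)

    Hull⊆path : ∀ {Q} → IsPath Q → x₀ ∈ Q → Hull ⊆ Q
    Hull⊆path Q-path x₀∈Q y∈Hull =
      let (K , K-bridge , x₀∈K , y∈K) = unresize y∈Hull
      in bridge⊆path Q-path K-bridge x₀∈K x₀∈Q y∈K

    Hull-convex : IsConvex Hull
    Hull-convex {y₁} {y₂} y₁∈Hull y₃∈Hull y₁≤y₂ y₂≤y₃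
      with unresize y₁∈Hull | unresize y₃∈Hull
         | proj₁ P-path (path-downClosed P-path (Hull⊆path P-path x₀∈P y₃∈Hull) y₂≤y₃) x₀∈P
    ... | K₁ , K₁-bridge , x₀∈K₁ , y₁∈K₁ | _ , _ , _ , _ | inj₁ y₂<x₀ =
      bridge⊆Hull K₁-bridge x₀∈K₁ (proj₁ (proj₂ K₁-bridge) y₁∈K₁ x₀∈K₁ y₁≤y₂ (inj₁ y₂<x₀))
    ... | K₁ , K₁-bridge , x₀∈K₁ , _ | _ , _ , _ , _ | inj₂ (inj₁ refl) =
      bridge⊆Hull K₁-bridge x₀∈K₁ x₀∈K₁
    ... | _ , _ , _ , _ | K₃ , K₃-bridge , x₀∈K₃ , y₃∈K₃ | inj₂ (inj₂ x₀<y₂) =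
      bridge⊆Hull K₃-bridge x₀∈K₃ (proj₁ (proj₂ K₃-bridge) x₀∈K₃ y₃∈K₃ (inj₁ x₀<y₂) y₂≤y₃)

    Hull-bridgeCondition : ∀ Q → IsPath Q → Hull ⊆ Q ⊎ Disjoint Hull Q
    Hull-bridgeCondition Q Q-path with em {P = NonEmpty (Hull ∩ Q)}
    ... | no ¬meets = inj₂ λ y y∈Hull y∈Q → ¬meets (y , y∈Hull , y∈Q)
    ... | yes (y , y∈Hull , y∈Q) =
      let (K , K-bridge , x₀∈K , y∈K) = unresize y∈Hull
      in inj₁ (Hull⊆path Q-path (bridge⊆path Q-path K-bridge y∈K y∈Q x₀∈K))

    Hull-isMaximalBridge : ∀ {I} → IsBridge I → x₀ ∈ I → IsMaximalBridge Hull
    Hull-isMaximalBridge I-bridge x₀∈I = Hull-bridge , λ J J-bridge Hull⊆J y∈J →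
      bridge⊆Hull J-bridge (Hull⊆J x₀∈Hull) y∈J
      where
      x₀∈Hull : x₀ ∈ Hull
      x₀∈Hull = bridge⊆Hull I-bridge x₀∈I x₀∈I
      Hull-bridge : IsBridge Hull
      Hull-bridge = (x₀ , x₀∈Hull) , Hull-convex ,
        (λ y∈Hull z∈Hull →
          proj₁ P-path (Hull⊆path P-path x₀∈P y∈Hull) (Hull⊆path P-path x₀∈P z∈Hull)) ,
        Hull-bridgeCondition

  branchFree-convex⇒bridge : WeaklyBranchingComplete → ∀ {P I} → IsPath P → I ⊆ P →
    NonEmpty I → IsConvex I → (∀ {w} → w ∈ I → ¬ WeaklyBranchingPoint w) → IsBridge I
  branchFree-convex⇒bridge wbc {P} {I} P-path I⊆P I-nonEmpty I-convex I-branchFree =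
    I-nonEmpty , I-convex , (λ x∈I y∈I → proj₁ P-path (I⊆P x∈I) (I⊆P y∈I)) , bridgeCondition
    where
    bridgeCondition : ∀ Q → IsPath Q → I ⊆ Q ⊎ Disjoint I Q
    bridgeCondition Q Q-path with em {P = NonEmpty (I ∩ Q)}
    ... | no ¬meets = inj₂ λ y y∈I y∈Q → ¬meets (y , y∈I , y∈Q)
    ... | yes (y , y∈I , y∈Q) = inj₁ λ z∈I → dne (branching-between z∈I)
      where
      branching-between : ∀ {z} → z ∈ I → z ∉ Q → ⊥
      branching-between {z} z∈I z∉Q = I-branchFree w∈I (P , Q , P-path , Q-path , P≢Q , w-sup)
        where
        P≢Q : Distinct P Q
        P≢Q (P⊆Q , _) = z∉Q (P⊆Q (I⊆P z∈I))
        w = proj₁ (proj₁ (wbc P Q P-path Q-path P≢Q))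
        w-sup = proj₂ (proj₁ (wbc P Q P-path Q-path P≢Q))
        w∈I : w ∈ I
        w∈I = I-convex y∈I z∈I (proj₁ (proj₂ w-sup) (I⊆P y∈I , y∈Q))
          (proj₂ (proj₂ w-sup) z (I⊆P z∈I) λ q∈P∩Q →
            ∩-below-outside P-path Q-path q∈P∩Q (I⊆P z∈I , z∉Q))

  module FromPathwiseComplete (pc : PathwiseComplete) where

    hasSupIn : ∀ {P X} → IsPath P → X ⊆ P → NonEmpty X → BoundedAbove X → HasSupIn P X
    hasSupIn {P} {X} P-path X⊆P (x , x∈X) (u , u-ub) =
      m , m∈P , (λ y∈X → m-greatest _ (X⊆P y∈X) λ v∈Ub → proj₂ v∈Ub y∈X) ,
      λ b b∈P b-ub → m-lb (b∈P , b-ub)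
      where
      Ub : Subset
      Ub v = v ∈ P × UpperBound X v
      inf = pc P P-path Ub proj₁ (upperBound-inPath P-path X⊆P u-ub) (x , λ v∈Ub → proj₂ v∈Ub x∈X)
      m = proj₁ inf
      m∈P = proj₁ (proj₂ inf)
      m-lb = proj₁ (proj₂ (proj₂ inf))
      m-greatest = proj₂ (proj₂ (proj₂ inf))

    intersection-hasSupIn : ∀ {P Q} → IsPath P → IsPath Q → ¬ P ⊆ Q → HasSupIn P (P ∩ Q)
    intersection-hasSupIn {P} {Q} P-path Q-path P⊈Q
      with em {P = ∃ λ t → t ∈ P ∩ Q × UpperBound (P ∩ Q) t}
    ... | yes (t , t∈P∩Q , t-ub) = t , proj₁ t∈P∩Q , t-ub , λ _ _ b-ub → b-ub t∈P∩Q
    ... | no no-maximum =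
      m , m∈P ,
      (λ x∈P∩Q → m-greatest _ (proj₁ x∈P∩Q) (∩-below-outside P-path Q-path x∈P∩Q)) ,
      m-least
      where
      P∖Q-nonEmpty : NonEmpty (P ∖ Q)
      P∖Q-nonEmpty = ¬∀⇒∃¬ {P} {Q} P⊈Q
      P∩Q-nonEmpty : NonEmpty (P ∩ Q)
      P∩Q-nonEmpty = paths-meet P-path Q-path (proj₁ (proj₂ P∖Q-nonEmpty))
      inf = pc P P-path (P ∖ Q) proj₁ P∖Q-nonEmpty
        (proj₁ P∩Q-nonEmpty , ∩-below-outside P-path Q-path (proj₂ P∩Q-nonEmpty))
      m = proj₁ inf
      m∈P = proj₁ (proj₂ inf)
      m-lb = proj₁ (proj₂ (proj₂ inf))
      m-greatest = proj₂ (proj₂ (proj₂ inf))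
      m-least : ∀ b → b ∈ P → UpperBound (P ∩ Q) b → m ≤ b
      m-least b b∈P b-ub with em {P = b ∈ Q}
      ... | yes b∈Q = ⊥-elim (no-maximum (b , (b∈P , b∈Q) , b-ub))
      ... | no b∉Q  = m-lb (b∈P , b∉Q)

    weaklyBranchingComplete : WeaklyBranchingComplete
    weaklyBranchingComplete P Q P-path Q-path P≢Q =
      intersection-hasSupIn P-path Q-path (λ P⊆Q → P≢Q (P⊆Q , path-⊆⇒⊇ P-path Q-path P⊆Q)) ,
      hasSupIn-cong swap swap
        (intersection-hasSupIn Q-path P-path λ Q⊆P → P≢Q (path-⊆⇒⊇ Q-path P-path Q⊆P , Q⊆P))

    weaklyBranchingPointComplete : WeaklyBranchingPointComplete
    weaklyBranchingPointComplete P P-path X X⊆P _ X-nonEmpty =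
      pc P P-path X X⊆P X-nonEmpty , hasSupIn P-path X⊆P X-nonEmpty

    convex⊆path⇒dedekindComplete : ∀ {P J} → IsPath P → J ⊆ P → IsConvex J → DedekindComplete J
    convex⊆path⇒dedekindComplete {P} P-path J⊆P J-convex X X⊆J (x , x∈X) (c , c∈J , c-lb) =
      m , J-convex c∈J (X⊆J x∈X) (m-greatest c (J⊆P c∈J) c-lb) (m-lb x∈X) , m-lb ,
      λ b b∈J b-lb → m-greatest b (J⊆P b∈J) b-lb
      where
      inf = pc P P-path X (λ y∈X → J⊆P (X⊆J y∈X)) (x , x∈X) (c , c-lb)
      m = proj₁ inf
      m-lb = proj₁ (proj₂ (proj₂ inf))
      m-greatest = proj₂ (proj₂ (proj₂ inf))

    maximalBridge-dedekindComplete : ∀ J → IsMaximalBridge J → DedekindComplete J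
    maximalBridge-dedekindComplete J J-maximal =
      let (P , P-path , J⊆P) = maximalBridge⊆path J-maximal
      in convex⊆path⇒dedekindComplete P-path J⊆P (proj₁ (proj₂ (proj₁ J-maximal)))

  module ToPathwiseComplete (wbc : WeaklyBranchingComplete) (wbpc : WeaklyBranchingPointComplete)
    (dedekind : ∀ J → IsMaximalBridge J → DedekindComplete J) where

    module Infimum {P X b} (P-path : IsPath P) (X⊆P : X ⊆ P) (b-lb : LowerBound X b) where

      LowerBranching : Subset
      LowerBranching w = w ∈ P × Resize (WeaklyBranchingPoint w) × LowerBound X w

      UpperBranching : Subset
      UpperBranching w = w ∈ P × Resize (WeaklyBranchingPoint w) × ¬ LowerBound X w

      Gap : Subset
      Gap p = p ∈ P × (∀ {a} → a ∈ LowerBranching → a < p) × (∀ {w} → w ∈ UpperBranching → p < w)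

      UpperBranching-aboveX : ∀ {w} → w ∈ UpperBranching → ∃ λ x → x ∈ X × x < w
      UpperBranching-aboveX (w∈P , _ , ¬w-lb) = ¬lowerBound⇒above P-path X⊆P w∈P ¬w-lb

      lowerBound<UpperBranching : ∀ {l w} → LowerBound X l → w ∈ UpperBranching → l < w
      lowerBound<UpperBranching l-lb w∈U =
        let (x , x∈X , x<w) = UpperBranching-aboveX w∈U in ≤-<-trans (l-lb x∈X) x<w

      lowerBound∈Gap : ∀ {l} → l ∈ P → LowerBound X l →
        (∀ {a} → a ∈ LowerBranching → a < l) → l ∈ Gap
      lowerBound∈Gap l∈P l-lb L<l = l∈P , L<l , lowerBound<UpperBranching l-lb

      Gap-convex : IsConvex Gap
      Gap-convex (_ , L<x , _) (z∈P , _ , z<U) x≤y y≤z =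
        path-downClosed P-path z∈P y≤z , (λ a∈L → <-≤-trans (L<x a∈L) x≤y) ,
        λ w∈U → ≤-<-trans y≤z (z<U w∈U)

      Gap-branchFree : ∀ {w} → w ∈ Gap → ¬ WeaklyBranchingPoint w
      Gap-branchFree {w} (w∈P , L<w , w<U) w-branching with em {P = LowerBound X w}
      ... | yes w-lb  = <-irrefl w (L<w (w∈P , resize w-branching , w-lb))
      ... | no ¬w-lb = <-irrefl w (w<U (w∈P , resize w-branching , ¬w-lb))

      hasInfIn-UpperBranchingCoinitial : NonEmpty X →
        (∀ {x} → x ∈ X → ∃ λ w → w ∈ UpperBranching × w ≤ x) → HasInfIn P X
      hasInfIn-UpperBranchingCoinitial (x , x∈X) X≥U =
        m , isInf-coinitial U≥X X≥U m-inf
        where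
        U≥X : ∀ {w} → w ∈ UpperBranching → ∃ λ x → x ∈ X × x ≤ w
        U≥X w∈U = let (x , x∈X , x<w) = UpperBranching-aboveX w∈U in x , x∈X , inj₁ x<w
        inf = proj₁ (wbpc P P-path UpperBranching proj₁ (λ w∈U → unresize (proj₁ (proj₂ w∈U)))
                (_ , proj₁ (proj₂ (X≥U x∈X)))) (b , λ w∈U → inj₁ (lowerBound<UpperBranching b-lb w∈U))
        m = proj₁ inf
        m-inf = proj₂ inf

      module FromGap {x₀} (x₀∈X : x₀ ∈ X) (x₀∈Gap : x₀ ∈ Gap) where
        x₀∈P = X⊆P x₀∈X
        open BridgesThrough P-path x₀∈P

        Gap-bridge : IsBridge Gap
        Gap-bridge =
          branchFree-convex⇒bridge wbc P-path proj₁ (x₀ , x₀∈Gap) Gap-convex Gap-branchFree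

        Gap⊆Hull : Gap ⊆ Hull
        Gap⊆Hull = bridge⊆Hull Gap-bridge x₀∈Gap

        NoLowerBoundInHull : Set ℓ
        NoLowerBoundInHull = ¬ (∃ λ l → l ∈ Hull × LowerBound X l)

        LowerBranching-nonEmpty : NoLowerBoundInHull → NonEmpty LowerBranching
        LowerBranching-nonEmpty no-lb∈Hull =
          dne λ L-empty → no-lb∈Hull (b , Gap⊆Hull (b∈Gap L-empty) , b-lb)
          where
          b∈Gap : ¬ NonEmpty LowerBranching → b ∈ Gap
          b∈Gap L-empty = lowerBound∈Gap (path-downClosed P-path x₀∈P (b-lb x₀∈X)) b-lb
            λ a∈L → ⊥-elim (L-empty (_ , a∈L))

        supLowerBranching-isInf : NoLowerBoundInHull → HasInfIn P X
        supLowerBranching-isInf no-lb∈Hull = s , s∈P , s-lb , s-greatest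
          where
          sup = proj₂ (wbpc P P-path LowerBranching proj₁ (λ a∈L → unresize (proj₁ (proj₂ a∈L)))
                  (LowerBranching-nonEmpty no-lb∈Hull)) (x₀ , λ a∈L → inj₁ (proj₁ (proj₂ x₀∈Gap) a∈L))
          s = proj₁ sup
          s∈P = proj₁ (proj₂ sup)
          s-ub = proj₁ (proj₂ (proj₂ sup))
          s-lb : LowerBound X s
          s-lb x∈X = proj₂ (proj₂ (proj₂ sup)) _ (X⊆P x∈X) λ a∈L → proj₂ (proj₂ a∈L) x∈X
          s-greatest : ∀ l → l ∈ P → LowerBound X l → l ≤ s
          s-greatest l l∈P l-lb = comparable⇒≤ (proj₁ P-path l∈P s∈P) λ s<l → no-lb∈Hull
            (l , Gap⊆Hull (lowerBound∈Gap l∈P l-lb λ a∈L → ≤-<-trans (s-ub a∈L) s<l) , l-lb)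

        hasInfIn : HasInfIn P X
        hasInfIn with em {P = ∃ λ l → l ∈ Hull × LowerBound X l}
        ... | yes (l , l∈Hull , l-lb) =
          convex-dedekindComplete⇒hasInfIn P-path X⊆P (Hull⊆path P-path x₀∈P) Hull-convex
            (dedekind Hull (Hull-isMaximalBridge Gap-bridge x₀∈Gap))
            x₀∈X (Gap⊆Hull x₀∈Gap) l∈Hull l-lb
        ... | no no-lb∈Hull = supLowerBranching-isInf no-lb∈Hull

      hasInfIn : NonEmpty X → HasInfIn P X
      hasInfIn X-nonEmpty with em {P = ∀ {x} → x ∈ X → ∃ λ w → w ∈ UpperBranching × w ≤ x}
      ... | yes X≥U = hasInfIn-UpperBranchingCoinitial X-nonEmpty X≥U
      ... | no ¬X≥U with ¬∀⇒∃¬ ¬X≥U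
      ...   | x₀ , x₀∈X , ¬U≤x₀ with em {P = ∃ λ a → a ∈ LowerBranching × ¬ a < x₀}
      ...     | no some-L≮x₀ = FromGap.hasInfIn x₀∈X (X⊆P x₀∈X , L<x₀ , x₀<U)
        where
        L<x₀ : ∀ {a} → a ∈ LowerBranching → a < x₀
        L<x₀ a∈L = dne λ a≮x₀ → some-L≮x₀ (_ , a∈L , a≮x₀)
        x₀<U : ∀ {w} → w ∈ UpperBranching → x₀ < w
        x₀<U w∈U =
          comparable⇒< (proj₁ P-path (X⊆P x₀∈X) (proj₁ w∈U)) λ w≤x₀ → ¬U≤x₀ (_ , w∈U , w≤x₀)
      ...     | yes (a , (_ , _ , a-lb) , a≮x₀) with a-lb x₀∈X
      ...       | inj₁ a<x₀ = ⊥-elim (a≮x₀ a<x₀)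
      ...       | inj₂ refl = a , minimum-isInf (X⊆P x₀∈X) x₀∈X a-lb

    pathwiseComplete : PathwiseComplete
    pathwiseComplete P P-path X X⊆P X-nonEmpty (_ , b-lb) =
      Infimum.hasInfIn P-path X⊆P b-lb X-nonEmpty

mainTheorem9 : (∀ {a} → ExcludedMiddle a) → ∀ {ℓ : Level} (T : Tree ℓ) →
    let open TreeNotions T in
    PathwiseComplete ⇔
      (WeaklyBranchingComplete × WeaklyBranchingPointComplete ×
        (∀ J → IsMaximalBridge J → DedekindComplete J))
mainTheorem9 em T = mk⇔
  (λ pc → let open Classical.FromPathwiseComplete em T pc in
    weaklyBranchingComplete , weaklyBranchingPointComplete , maximalBridge-dedekindComplete)
  (λ (wbc , wbpc , dedekind) → Classical.ToPathwiseComplete.pathwiseComplete em T wbc wbpc dedekind)
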